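{- Let $M$ be a matroid and $x$ an element of $M$. Suppose every antichain $\mathcal{A}$ of $\mathcal{Z}(M)$ can be listed as $A_1,\ldots,A_t$ so that (i) $A_i\lor A_{i+1}\lor\cdots\lor A_k=A_i\lor A_k$ in $\mathcal{Z}(M)$ whenever $1\le i<k\le t$, and (ii) $r_M(A_1\cap\cdots\cap A_t)\le\sum_{i=1}^t r_M(A_i)-\sum_{i=1}^{t-1}r_M(A_i\cup A_{i+1})$. Then the same holds for $M\backslash x$ and for $M/x$: every antichain of $\mathcal{Z}(M\backslash x)$ (respectively $\mathcal{Z}(M/x)$) can be listed so that (i) holds with joins in $\mathcal{Z}(M\backslash x)$ (respectively $\mathcal{Z}(M/x)$) and (ii) holds with the rank function of $M\backslash x$ (respectively $M/x$).
   Context: All matroids are finite. A flat $X$ of a matroid $N$ is cyclic if $N|X$ has no isthmuses. The cyclic flats of $N$ ordered by inclusion form a lattice $\mathcal{Z}(N)$, in which $A\lor B=\mathrm{cl}_N(A\cup B)$ and $A\land B$ is the union of the circuits of $N$ contained in $A\cap B$. -}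

module Defs where

open import Data.Nat using (ℕ; zero; suc; _+_; _∸_; _≤_; _≡ᵇ_)
open import Data.Bool using (Bool; _∧_)
open import Data.Fin using (Fin)
open import Data.Fin.Subset using (Subset; _∈_; _⊆_; _∪_; _∩_; _-_; ⁅_⁆; ∣_∣)
open import Data.Vec using (tabulate; lookup)
open import Data.List using (List; []; _∷_; _++_; [_]; foldr)
open import Data.List.Relation.Unary.All using (All)
open import Data.List.Relation.Unary.AllPairs using (AllPairs)
open import Data.List.Relation.Binary.Permutation.Propositional using (_↭_)
open import Data.Product using (_×_; ∃-syntax)
open import Data.Unit using (⊤)
open import Relation.Binary.PropositionalEquality using (_≡_; _≢_)
open import Relation.Nullary using (¬_)

-- A "matroid presentation" on the universe Fin n: a ground set E ⊆ Fin n
-- and a rank function (only its values on subsets of E matter).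
record MatroidData (n : ℕ) : Set where
  constructor mkMatroidData
  field
    E : Subset n
    r : Subset n → ℕ

open MatroidData public

record IsMatroid {n : ℕ} (M : MatroidData n) : Set where
  field
    r-bound   : ∀ X → X ⊆ E M → r M X ≤ ∣ X ∣
    r-mono    : ∀ X Y → Y ⊆ E M → X ⊆ Y → r M X ≤ r M Y
    r-submod  : ∀ X Y → X ⊆ E M → Y ⊆ E M →
                r M (X ∪ Y) + r M (X ∩ Y) ≤ r M X + r M Y

delete : ∀ {n} → MatroidData n → Fin n → MatroidData n
delete M x = mkMatroidData (E M - x) (r M)

contract : ∀ {n} → MatroidData n → Fin n → MatroidData n
contract M x = mkMatroidData (E M - x) (λ X → r M (X ∪ ⁅ x ⁆) ∸ r M ⁅ x ⁆)

cl : ∀ {n} → MatroidData n → Subset n → Subset n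
cl M X = tabulate (λ e → lookup (E M) e ∧ (r M (X ∪ ⁅ e ⁆) ≡ᵇ r M X))

IsFlat : ∀ {n} → MatroidData n → Subset n → Set
IsFlat M X = (X ⊆ E M) × (cl M X ≡ X)

NoIsthmus : ∀ {n} → MatroidData n → Subset n → Set
NoIsthmus M X = ∀ e → e ∈ X → r M (X - e) ≡ r M X

IsCyclicFlat : ∀ {n} → MatroidData n → Subset n → Set
IsCyclicFlat M X = IsFlat M X × NoIsthmus M X

join : ∀ {n} → MatroidData n → Subset n → Subset n → Subset n
join M A B = cl M (A ∪ B)

bigJoin : ∀ {n} → MatroidData n → Subset n → List (Subset n) → Subset n
bigJoin M a []       = a
bigJoin M a (b ∷ bs) = join M a (bigJoin M b bs)

-- A (finite, nonempty) antichain of Z(M), given as a list of distinct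
-- pairwise incomparable cyclic flats.
IsAntichain : ∀ {n} → MatroidData n → List (Subset n) → Set
IsAntichain M L =
  (L ≢ []) × All (IsCyclicFlat M) L × AllPairs (λ A B → ¬ (A ⊆ B) × ¬ (B ⊆ A)) L

-- Condition (i): for every i < k, A_i ∨ A_{i+1} ∨ … ∨ A_k = A_i ∨ A_k.
Cond1 : ∀ {n} → MatroidData n → List (Subset n) → Set
Cond1 {n} M L = ∀ (xs : List (Subset n)) (a : Subset n) (ys : List (Subset n))
  (b : Subset n) (zs : List (Subset n)) →
  L ≡ xs ++ (a ∷ (ys ++ (b ∷ zs))) →
  bigJoin M a (ys ++ [ b ]) ≡ join M a b

sumRanks : ∀ {n} → MatroidData n → List (Subset n) → ℕ
sumRanks M []       = 0
sumRanks M (a ∷ as) = r M a + sumRanks M as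

sumConsec : ∀ {n} → MatroidData n → Subset n → List (Subset n) → ℕ
sumConsec M a []       = 0
sumConsec M a (b ∷ bs) = r M (a ∪ b) + sumConsec M b bs

-- Condition (ii): r(A₁ ∩ ⋯ ∩ A_t) ≤ Σ r(A_i) − Σ r(A_i ∪ A_{i+1}),
-- stated without truncated subtraction (moving the second sum to the left).
Cond2 : ∀ {n} → MatroidData n → List (Subset n) → Set
Cond2 M []       = ⊤
Cond2 M (a ∷ as) = r M (foldr _∩_ a as) + sumConsec M a as ≤ sumRanks M (a ∷ as)

GoodListing : ∀ {n} → MatroidData n → Set
GoodListing {n} M = ∀ (L : List (Subset n)) → IsAntichain M L →
  ∃[ L' ] ((L' ↭ L) × Cond1 M L' × Cond2 M L')

module Submission where

-- Cyclic flats F of M \ x and of M / x lift to cyclic flats cl_M F of M with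
-- cl_M F - x = F, and incomparability is preserved. So an antichain of the minor lifts to
-- one of Z(M); removing x from each member of a good listing of the lift lists the
-- original antichain, and (i) and (ii) survive:
--
-- * In M \ x, each lifted flat Z (and every join of such) is spanned by Z - x, so removing
--   x changes neither closures nor ranks, and r (⋂ (A_i - x)) ≤ r (⋂ A_i).
-- * In M / x, joins are cl_M (· ∪ x) - x and ranks are r_M (· ∪ x) - r_M {x}; the constant
--   cancels in (ii). Passing from r to r (· ∪ x) preserves (ii) on flats: adding x raises
--   the rank of a flat A_i by 1 exactly when x ∉ A_i, that of A_i ∪ A_{i+1} only when
--   x ∉ A_i and x ∉ A_{i+1}, and that of ⋂ A_i only when x misses some A_i.

open import Defs
open import Data.Nat using (ℕ; zero; suc; _+_; _*_; _∸_; _≤_; _<_)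
open import Data.Nat.Properties
open import Data.Bool using (_∧_; _∨_)
open import Data.Bool.Properties using (T-≡; T-∧)
open import Data.Fin using (Fin; zero; suc) renaming (_≟_ to _≟ᶠ_)
open import Data.Fin.Subset using (Subset; _∈_; _∉_; _⊆_; _∪_; _∩_; _─_; _-_; ⁅_⁆; ∣_∣; inside; outside)
open import Data.Fin.Subset.Properties
open import Data.Vec using (_∷_; []; here; there; lookup; tabulate)
open import Data.Vec.Properties using (lookup∘tabulate; []=⇒lookup; lookup⇒[]=)
open import Data.List using (List; []; _∷_; _++_; [_]; map; foldr; length)
open import Data.List.Properties using (∷-injectiveˡ; ∷-injectiveʳ; map-++; map-∘; map-id-local; ++-conicalʳ)
open import Data.List.Relation.Unary.All using (All; []; _∷_)
import Data.List.Relation.Unary.All as All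
import Data.List.Relation.Unary.All.Properties as All
open import Data.List.Relation.Unary.AllPairs using (AllPairs; []; _∷_)
import Data.List.Relation.Unary.AllPairs.Properties as AllPairs
open import Data.List.Relation.Binary.Permutation.Propositional using (_↭_; ↭-reflexive; ↭-trans; ↭-sym)
open import Data.List.Relation.Binary.Permutation.Propositional.Properties using (All-resp-↭)
import Data.List.Relation.Binary.Permutation.Propositional.Properties as ↭
open import Algebra.Properties.CommutativeSemigroup +-commutativeSemigroup using (interchange)
open import Data.Product using (_×_; _,_; proj₁; proj₂; ∃-syntax)
open import Data.Sum using (inj₁; inj₂)
open import Function using (Equivalence; _∘_; _on_)
open import Relation.Binary.PropositionalEquality hiding ([_])
open import Relation.Nullary using (¬_; yes; no)
open import Data.Nat.Tactic.RingSolver using (solve-∀)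
import Algebra.Solver.IdempotentCommutativeMonoid as ∪-Solver

private
  variable
    n : ℕ

-- Finite subsets

x∈p─q⇒x∉q : ∀ {x : Fin n} (p q : Subset n) → x ∈ p ─ q → x ∉ q
x∈p─q⇒x∉q (inside ∷ p) (outside ∷ q) here ()
x∈p─q⇒x∉q (s ∷ p) (t ∷ q) (there x∈p─q) (there x∈q) = x∈p─q⇒x∉q p q x∈p─q x∈q

x∈p-y⇒x≢y : ∀ {x y : Fin n} (p : Subset n) → x ∈ p - y → x ≢ y
x∈p-y⇒x≢y {y = y} p x∈p-y refl = x∈p─q⇒x∉q p ⁅ y ⁆ x∈p-y (x∈⁅x⁆ y)

p-x⊆p : ∀ (p : Subset n) {x} → p - x ⊆ p
p-x⊆p p {x} = p─q⊆p p ⁅ x ⁆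

x∈p⇒⁅x⁆⊆p : ∀ {x : Fin n} {p} → x ∈ p → ⁅ x ⁆ ⊆ p
x∈p⇒⁅x⁆⊆p {x = x} x∈p y∈⁅x⁆ = subst (_∈ _) (sym (x∈⁅y⁆⇒x≡y x y∈⁅x⁆)) x∈p

∪-lub : ∀ {p q s : Subset n} → p ⊆ s → q ⊆ s → p ∪ q ⊆ s
∪-lub {p = p} {q} p⊆s q⊆s x∈p∪q with x∈p∪q⁻ p q x∈p∪q
... | inj₁ x∈p = p⊆s x∈p
... | inj₂ x∈q = q⊆s x∈q

∪-mono-⊆ : ∀ {p p′ q q′ : Subset n} → p ⊆ p′ → q ⊆ q′ → p ∪ q ⊆ p′ ∪ q′
∪-mono-⊆ {p′ = p′} p⊆p′ q⊆q′ =
  ∪-lub (λ x∈p → p⊆p∪q _ (p⊆p′ x∈p)) (λ x∈q → q⊆p∪q p′ _ (q⊆q′ x∈q))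

q⊆p⇒p∪q≡p : ∀ {p q : Subset n} → q ⊆ p → p ∪ q ≡ p
q⊆p⇒p∪q≡p q⊆p = ⊆-antisym (∪-lub (λ x∈p → x∈p) q⊆p) (p⊆p∪q _)

─-mono-⊆ : ∀ {p q : Subset n} (s : Subset n) → p ⊆ q → p ─ s ⊆ q ─ s
─-mono-⊆ {p = p} s p⊆q x∈p─s =
  x∈p∧x∉q⇒x∈p─q (p⊆q (p─q⊆p p s x∈p─s)) (x∈p─q⇒x∉q p s x∈p─s)

p∪q∪s≡p∪s∪q : ∀ (p q s : Subset n) → (p ∪ q) ∪ s ≡ (p ∪ s) ∪ q
p∪q∪s≡p∪s∪q p q s = trans (∪-assoc p q s) (trans (cong (p ∪_) (∪-comm q s)) (sym (∪-assoc p s q)))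

p─q∪q≡p∪q : ∀ (p q : Subset n) → (p ─ q) ∪ q ≡ p ∪ q
p─q∪q≡p∪q []            []            = refl
p─q∪q≡p∪q (inside ∷ p)  (inside ∷ q)  = cong (inside ∷_) (p─q∪q≡p∪q p q)
p─q∪q≡p∪q (outside ∷ p) (inside ∷ q)  = cong (inside ∷_) (p─q∪q≡p∪q p q)
p─q∪q≡p∪q (s ∷ p)       (outside ∷ q) = cong ((s ∨ outside) ∷_) (p─q∪q≡p∪q p q)

─-distribʳ-∩ : ∀ (p q s : Subset n) → (p ∩ q) ─ s ≡ (p ─ s) ∩ (q ─ s)
─-distribʳ-∩ []      []      []            = refl
─-distribʳ-∩ (a ∷ p) (b ∷ q) (inside ∷ s)  = cong (outside ∷_) (─-distribʳ-∩ p q s)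
─-distribʳ-∩ (a ∷ p) (b ∷ q) (outside ∷ s) = cong ((a ∧ b) ∷_) (─-distribʳ-∩ p q s)

─-distribʳ-∪ : ∀ (p q s : Subset n) → (p ∪ q) ─ s ≡ (p ─ s) ∪ (q ─ s)
─-distribʳ-∪ []      []      []            = refl
─-distribʳ-∪ (a ∷ p) (b ∷ q) (inside ∷ s)  = cong (outside ∷_) (─-distribʳ-∪ p q s)
─-distribʳ-∪ (a ∷ p) (b ∷ q) (outside ∷ s) = cong ((a ∨ b) ∷_) (─-distribʳ-∪ p q s)

foldr-∩-─ : ∀ (s a : Subset n) as → foldr _∩_ (a ─ s) (map (_─ s) as) ≡ foldr _∩_ a as ─ s
foldr-∩-─ s a []       = refl
foldr-∩-─ s a (b ∷ bs) = trans (cong ((b ─ s) ∩_) (foldr-∩-─ s a bs)) (sym (─-distribʳ-∩ b _ s))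

∈-foldr-∩ : ∀ {x : Fin n} {a} {as} → x ∈ a → All (x ∈_) as → x ∈ foldr _∩_ a as
∈-foldr-∩ x∈a []           = x∈a
∈-foldr-∩ x∈a (x∈b ∷ x∈bs) = x∈p∩q⁺ (x∈b , ∈-foldr-∩ x∈a x∈bs)

foldr-∩⊆ : ∀ (a : Subset n) as → foldr _∩_ a as ⊆ a
foldr-∩⊆ a []       x∈a = x∈a
foldr-∩⊆ a (b ∷ bs) x∈∩ = foldr-∩⊆ a bs (proj₂ (x∈p∩q⁻ b _ x∈∩))

-- Rank and closure

module _ (M : MatroidData n) {X : Subset n} {e : Fin n} where
  open Equivalence using (to; from)

  ∈-cl⁻ : e ∈ cl M X → e ∈ E M × r M (X ∪ ⁅ e ⁆) ≡ r M X
  ∈-cl⁻ e∈clX =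
    let tE , tr = to T-∧ (from T-≡ (trans (sym (lookup∘tabulate _ e)) ([]=⇒lookup e∈clX)))
    in lookup⇒[]= e (E M) (to T-≡ tE) , ≡ᵇ⇒≡ _ _ tr

  ∈-cl⁺ : e ∈ E M → r M (X ∪ ⁅ e ⁆) ≡ r M X → e ∈ cl M X
  ∈-cl⁺ e∈E rank≡ = lookup⇒[]= e (cl M X) (trans (lookup∘tabulate _ e)
    (to T-≡ (from T-∧ (from T-≡ ([]=⇒lookup e∈E) , ≡⇒≡ᵇ _ _ rank≡))))

cl⊆E : ∀ (M : MatroidData n) {X} → cl M X ⊆ E M
cl⊆E M e∈clX = proj₁ (∈-cl⁻ M e∈clX)

bigJoin⊆E : ∀ (M : MatroidData n) {a} bs → a ⊆ E M → bigJoin M a bs ⊆ E M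
bigJoin⊆E M []      a⊆E = a⊆E
bigJoin⊆E M (_ ∷ _) _   = cl⊆E M

module Closure {M : MatroidData n} (isM : IsMatroid M) where
  open IsMatroid isM

  r-monotone : ∀ {X Y} → X ⊆ Y → Y ⊆ E M → r M X ≤ r M Y
  r-monotone {X} {Y} X⊆Y Y⊆E = r-mono X Y Y⊆E X⊆Y

  r-∪⁅⁆≤r+1 : ∀ {Y e} → Y ⊆ E M → e ∈ E M → r M (Y ∪ ⁅ e ⁆) ≤ r M Y + 1
  r-∪⁅⁆≤r+1 {Y} {e} Y⊆E e∈E = begin
    r M (Y ∪ ⁅ e ⁆)                      ≤⟨ m≤m+n _ _ ⟩
    r M (Y ∪ ⁅ e ⁆) + r M (Y ∩ ⁅ e ⁆)    ≤⟨ r-submod Y ⁅ e ⁆ Y⊆E (x∈p⇒⁅x⁆⊆p e∈E) ⟩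
    r M Y + r M ⁅ e ⁆                    ≤⟨ +-monoʳ-≤ (r M Y) r⁅e⁆≤1 ⟩
    r M Y + 1                            ∎
    where
    open ≤-Reasoning
    r⁅e⁆≤1 : r M ⁅ e ⁆ ≤ 1
    r⁅e⁆≤1 = subst (r M ⁅ e ⁆ ≤_) (∣⁅x⁆∣≡1 e) (r-bound ⁅ e ⁆ (x∈p⇒⁅x⁆⊆p e∈E))

  ⊆cl : ∀ {X} → X ⊆ E M → X ⊆ cl M X
  ⊆cl X⊆E e∈X = ∈-cl⁺ M (X⊆E e∈X) (cong (r M) (q⊆p⇒p∪q≡p (x∈p⇒⁅x⁆⊆p e∈X)))

  ∉cl⇒r<r-∪⁅⁆ : ∀ {Z e} → Z ⊆ E M → e ∈ E M → e ∉ cl M Z → r M Z < r M (Z ∪ ⁅ e ⁆)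
  ∉cl⇒r<r-∪⁅⁆ Z⊆E e∈E e∉clZ = ≤∧≢⇒<
    (r-monotone (p⊆p∪q _) (∪-lub Z⊆E (x∈p⇒⁅x⁆⊆p e∈E)))
    (λ r≡ → e∉clZ (∈-cl⁺ M e∈E (sym r≡)))

  -- Submodularity applied to Y and X ∪ {e}, whose union is Y ∪ {e}.
  r-∪-∈cl : ∀ {X Y e} → e ∈ cl M X → X ⊆ Y → Y ⊆ E M → r M (Y ∪ ⁅ e ⁆) ≡ r M Y
  r-∪-∈cl {X} {Y} {e} e∈clX X⊆Y Y⊆E = ≤-antisym (+-cancelʳ-≤ (r M X) _ _ (begin
      r M (Y ∪ ⁅ e ⁆) + r M X                    ≤⟨ +-monoʳ-≤ _ (r-monotone X⊆Y∩Xe (λ z → Y⊆E (p∩q⊆p Y _ z))) ⟩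
      r M (Y ∪ ⁅ e ⁆) + r M (Y ∩ (X ∪ ⁅ e ⁆))    ≡⟨ cong (λ S → r M S + r M (Y ∩ (X ∪ ⁅ e ⁆))) Y∪Xe≡Ye ⟨
      r M (Y ∪ (X ∪ ⁅ e ⁆)) + r M (Y ∩ (X ∪ ⁅ e ⁆)) ≤⟨ r-submod Y (X ∪ ⁅ e ⁆) Y⊆E (∪-lub (λ z → Y⊆E (X⊆Y z)) ⁅e⁆⊆E) ⟩
      r M Y + r M (X ∪ ⁅ e ⁆)                    ≡⟨ cong (r M Y +_) (proj₂ (∈-cl⁻ M e∈clX)) ⟩
      r M Y + r M X                              ∎))
    (r-monotone (p⊆p∪q _) (∪-lub Y⊆E ⁅e⁆⊆E))
    where
    open ≤-Reasoning
    ⁅e⁆⊆E : ⁅ e ⁆ ⊆ E M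
    ⁅e⁆⊆E = x∈p⇒⁅x⁆⊆p (cl⊆E M e∈clX)
    X⊆Y∩Xe : X ⊆ Y ∩ (X ∪ ⁅ e ⁆)
    X⊆Y∩Xe z∈X = x∈p∩q⁺ (X⊆Y z∈X , p⊆p∪q _ z∈X)
    Y∪Xe≡Ye : Y ∪ (X ∪ ⁅ e ⁆) ≡ Y ∪ ⁅ e ⁆
    Y∪Xe≡Ye = trans (sym (∪-assoc Y X ⁅ e ⁆)) (cong (_∪ ⁅ e ⁆) (q⊆p⇒p∪q≡p X⊆Y))

  cl-mono : ∀ {X Y} → X ⊆ Y → Y ⊆ E M → cl M X ⊆ cl M Y
  cl-mono X⊆Y Y⊆E e∈clX = ∈-cl⁺ M (cl⊆E M e∈clX) (r-∪-∈cl e∈clX X⊆Y Y⊆E)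

  r-∪-⊆cl : ∀ {X Y} → X ⊆ E M → Y ⊆ cl M X → r M (X ∪ Y) ≡ r M X
  r-∪-⊆cl {Y = Y} = go ∣ Y ∣ ≤-refl
    where
    go : ∀ k {X Y} → ∣ Y ∣ ≤ k → X ⊆ E M → Y ⊆ cl M X → r M (X ∪ Y) ≡ r M X
    go k {X} {Y} ∣Y∣≤k X⊆E Y⊆clX with nonempty? Y
    ... | no Y-empty = cong (r M) (trans (cong (X ∪_) (Empty-unique Y-empty)) (∪-identityʳ X))
    go zero    ∣Y∣≤0 X⊆E Y⊆clX | yes (e , e∈Y) with () ← ≤-trans (x∈p⇒∣p-x∣<∣p∣ e∈Y) ∣Y∣≤0
    go (suc k) {X} {Y} ∣Y∣≤k X⊆E Y⊆clX | yes (e , e∈Y) = begin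
      r M (X ∪ Y)                 ≡⟨ cong (r M) X∪Y≡X∪Y′∪e ⟩
      r M ((X ∪ (Y - e)) ∪ ⁅ e ⁆) ≡⟨ r-∪-∈cl (Y⊆clX e∈Y) (p⊆p∪q _) X∪Y′⊆E ⟩
      r M (X ∪ (Y - e))           ≡⟨ go k (≤-pred (≤-trans (x∈p⇒∣p-x∣<∣p∣ e∈Y) ∣Y∣≤k)) X⊆E (λ z → Y⊆clX (p-x⊆p Y z)) ⟩
      r M X                       ∎
      where
      open ≡-Reasoning
      X∪Y′⊆E : X ∪ (Y - e) ⊆ E M
      X∪Y′⊆E = ∪-lub X⊆E (λ z → cl⊆E M (Y⊆clX (p-x⊆p Y z)))
      X∪Y≡X∪Y′∪e : X ∪ Y ≡ (X ∪ (Y - e)) ∪ ⁅ e ⁆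
      X∪Y≡X∪Y′∪e = begin
        X ∪ Y                       ≡⟨ cong (X ∪_) (q⊆p⇒p∪q≡p (x∈p⇒⁅x⁆⊆p e∈Y)) ⟨
        X ∪ (Y ∪ ⁅ e ⁆)             ≡⟨ cong (X ∪_) (p─q∪q≡p∪q Y ⁅ e ⁆) ⟨
        X ∪ ((Y - e) ∪ ⁅ e ⁆)       ≡⟨ ∪-assoc X (Y - e) ⁅ e ⁆ ⟨
        (X ∪ (Y - e)) ∪ ⁅ e ⁆       ∎

  r-between : ∀ {X Y} → X ⊆ E M → X ⊆ Y → Y ⊆ cl M X → r M Y ≡ r M X
  r-between {X} {Y} X⊆E X⊆Y Y⊆clX =
    trans (cong (r M) (trans (sym (q⊆p⇒p∪q≡p X⊆Y)) (∪-comm Y X))) (r-∪-⊆cl X⊆E Y⊆clX)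

  r-cl : ∀ {X} → X ⊆ E M → r M (cl M X) ≡ r M X
  r-cl X⊆E = r-between X⊆E (⊆cl X⊆E) (λ z → z)

  cl-between : ∀ {X Y} → X ⊆ E M → X ⊆ Y → Y ⊆ cl M X → cl M Y ≡ cl M X
  cl-between {X} {Y} X⊆E X⊆Y Y⊆clX = ⊆-antisym clY⊆clX (cl-mono X⊆Y Y⊆E)
    where
    Y⊆E : Y ⊆ E M
    Y⊆E z = cl⊆E M (Y⊆clX z)
    clY⊆clX : cl M Y ⊆ cl M X
    clY⊆clX {e} e∈clY = ∈-cl⁺ M e∈E (≤-antisym (begin
        r M (X ∪ ⁅ e ⁆) ≤⟨ r-monotone (∪-mono-⊆ X⊆Y (λ z → z)) (∪-lub Y⊆E (x∈p⇒⁅x⁆⊆p e∈E)) ⟩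
        r M (Y ∪ ⁅ e ⁆) ≡⟨ proj₂ (∈-cl⁻ M e∈clY) ⟩
        r M Y           ≡⟨ r-between X⊆E X⊆Y Y⊆clX ⟩
        r M X           ∎)
      (r-monotone (p⊆p∪q _) (∪-lub X⊆E (x∈p⇒⁅x⁆⊆p e∈E))))
      where
      open ≤-Reasoning
      e∈E = cl⊆E M e∈clY

  cl-idem : ∀ {X} → X ⊆ E M → cl M (cl M X) ≡ cl M X
  cl-idem X⊆E = cl-between X⊆E (⊆cl X⊆E) (λ z → z)

  cl-∪-cl : ∀ {A B} → A ⊆ E M → B ⊆ E M → cl M (A ∪ cl M B) ≡ cl M (A ∪ B)
  cl-∪-cl {A} {B} A⊆E B⊆E = cl-between A∪B⊆E (∪-mono-⊆ (λ z → z) (⊆cl B⊆E))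
    (∪-lub (λ z → ⊆cl A∪B⊆E (p⊆p∪q _ z)) (cl-mono (q⊆p∪q A B) A∪B⊆E))
    where
    A∪B⊆E : A ∪ B ⊆ E M
    A∪B⊆E = ∪-lub A⊆E B⊆E

  cl-cyclicFlat : ∀ {F} → F ⊆ E M → (∀ {e} → e ∈ cl M F → r M F ≤ r M (cl M F - e)) →
    IsCyclicFlat M (cl M F)
  cl-cyclicFlat {F} F⊆E r≤r-cl- = (cl⊆E M , cl-idem F⊆E) , λ e e∈clF → ≤-antisym
    (r-monotone (p-x⊆p _) (cl⊆E M))
    (subst (_≤ r M (cl M F - e)) (sym (r-cl F⊆E)) (r≤r-cl- e∈clF))

  noIsthmus⇒cl-cyclicFlat : ∀ {F} → F ⊆ E M → NoIsthmus M F → IsCyclicFlat M (cl M F)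
  noIsthmus⇒cl-cyclicFlat {F} F⊆E noIsthmus = cl-cyclicFlat F⊆E r≤r-cl-
    where
    r≤r-cl- : ∀ {e} → e ∈ cl M F → r M F ≤ r M (cl M F - e)
    r≤r-cl- {e} _ with e ∈? F
    ... | yes e∈F = subst (_≤ r M (cl M F - e)) (noIsthmus e e∈F)
                      (r-monotone (─-mono-⊆ ⁅ e ⁆ (⊆cl F⊆E)) (λ z → cl⊆E M (p-x⊆p _ z)))
    ... | no e∉F  = r-monotone
                      (λ z∈F → x∈p∧x≢y⇒x∈p-y (⊆cl F⊆E z∈F) (λ { refl → e∉F z∈F }))
                      (λ z → cl⊆E M (p-x⊆p _ z))

-- Transporting good listings

map≡++⁻ : ∀ {A B : Set} (f : A → B) (L : List A) (xs ys : List B) → map f L ≡ xs ++ ys →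
  ∃[ L₁ ] ∃[ L₂ ] (L ≡ L₁ ++ L₂ × xs ≡ map f L₁ × ys ≡ map f L₂)
map≡++⁻ f L       []       ys eq = [] , L , refl , refl , sym eq
map≡++⁻ f (a ∷ L) (b ∷ xs) ys eq with map≡++⁻ f L xs ys (∷-injectiveʳ eq)
... | L₁ , L₂ , refl , refl , refl = a ∷ L₁ , L₂ , refl , cong (_∷ map f L₁) (sym (∷-injectiveˡ eq)) , refl

map≢[] : ∀ {A B : Set} (f : A → B) {L : List A} → L ≢ [] → map f L ≢ []
map≢[] f {[]}    L≢[] = λ _ → L≢[] refl
map≢[] f {_ ∷ _} _    = λ ()

Incomparable : Subset n → Subset n → Set
Incomparable A B = ¬ (A ⊆ B) × ¬ (B ⊆ A)

incomparable-map : ∀ (g h : Subset n → Subset n) → (∀ {p q} → p ⊆ q → h p ⊆ h q) →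
  ∀ {L} → All (λ F → h (g F) ≡ F) L → AllPairs Incomparable L → AllPairs Incomparable (map g L)
incomparable-map g h h-mono hg≡ pairs = AllPairs.map⁺ (go hg≡ pairs)
  where
  reflect : ∀ {F G} → h (g F) ≡ F → h (g G) ≡ G → g F ⊆ g G → F ⊆ G
  reflect hgF≡F hgG≡G gF⊆gG = subst₂ _⊆_ hgF≡F hgG≡G (h-mono gF⊆gG)
  go : ∀ {L} → All (λ F → h (g F) ≡ F) L → AllPairs Incomparable L → AllPairs (Incomparable on g) L
  go []             []              = []
  go (hgF≡F ∷ hg≡) (F⋈L ∷ pairs) = All.zipWith
    (λ { (hgG≡G , F⊈G , G⊈F) → F⊈G ∘ reflect hgF≡F hgG≡G , G⊈F ∘ reflect hgG≡G hgF≡F })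
    (hg≡ , F⋈L) ∷ go hg≡ pairs

Cond1-map : ∀ (A B : MatroidData n) (f g : Subset n → Subset n) {P : Subset n → Set} →
  (∀ {a bs} → P a → All P bs → bs ≢ [] → bigJoin A (f a) (map f bs) ≡ g (bigJoin B a bs)) →
  ∀ {L} → All P L → Cond1 B L → Cond1 A (map f L)
Cond1-map A B f g bigJoin-map {L} pL cond1 xs a ys b zs L≡ with map≡++⁻ f L xs _ L≡
... | L₁ , a′ ∷ L₂ , refl , refl , eq₂ with map≡++⁻ f L₂ ys _ (∷-injectiveʳ (sym eq₂)) | ∷-injectiveˡ eq₂
... | L₃ , b′ ∷ L₄ , refl , refl , eq₄ | refl with ∷-injectiveˡ eq₄
... | refl = begin
  bigJoin A (f a′) (map f L₃ ++ [ f b′ ])  ≡⟨ cong (bigJoin A (f a′)) (map-++ f L₃ [ b′ ]) ⟨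
  bigJoin A (f a′) (map f (L₃ ++ [ b′ ])) ≡⟨ bigJoin-map pa′ (All.++⁺ pL₃ (pb′ ∷ [])) L₃b′≢[] ⟩
  g (bigJoin B a′ (L₃ ++ [ b′ ]))         ≡⟨ cong g (cond1 L₁ a′ L₃ b′ L₄ refl) ⟩
  g (join B a′ b′)                        ≡⟨ bigJoin-map pa′ (pb′ ∷ []) (λ ()) ⟨
  join A (f a′) (f b′)                    ∎
  where
  open ≡-Reasoning
  pa′L₃b′L₄ = All.++⁻ʳ L₁ pL
  pa′ = All.head pa′L₃b′L₄
  pL₃ = All.++⁻ˡ L₃ (All.tail pa′L₃b′L₄)
  pb′ = All.head (All.++⁻ʳ L₃ (All.tail pa′L₃b′L₄))
  L₃b′≢[] : L₃ ++ [ b′ ] ≢ []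
  L₃b′≢[] eq with () ← ++-conicalʳ L₃ [ b′ ] eq

module RankShift (A B : MatroidData n) (f : Subset n → Subset n) (c : ℕ) {P : Subset n → Set}
  (r-shift : ∀ {Z} → P Z → r A (f Z) + c ≡ r B Z)
  (r-shift-∪ : ∀ {Z W} → P Z → P W → r A (f Z ∪ f W) + c ≡ r B (Z ∪ W)) where

  sumRanks-shift : ∀ {L} → All P L → sumRanks A (map f L) + length L * c ≡ sumRanks B L
  sumRanks-shift []        = refl
  sumRanks-shift {Z ∷ L} (pZ ∷ pL) = trans (interchange (r A (f Z)) _ c (length L * c))
    (cong₂ _+_ (r-shift pZ) (sumRanks-shift pL))

  sumConsec-shift : ∀ {a L} → P a → All P L → sumConsec A (f a) (map f L) + length L * c ≡ sumConsec B a L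
  sumConsec-shift pa []        = refl
  sumConsec-shift {a} {b ∷ L} pa (pb ∷ pL) = trans (interchange (r A (f a ∪ f b)) _ c (length L * c))
    (cong₂ _+_ (r-shift-∪ pa pb) (sumConsec-shift pb pL))

  Cond2-shift : ∀ {a as} → All P (a ∷ as) →
    r A (foldr _∩_ (f a) (map f as)) + c ≤ r B (foldr _∩_ a as) →
    Cond2 B (a ∷ as) → Cond2 A (map f (a ∷ as))
  Cond2-shift {a} {as} (pa ∷ pas) r∩≤ cond2 = +-cancelʳ-≤ (c + k) _ _ (begin
    (r A ∩A + sumConsec A (f a) (map f as)) + (c + k) ≡⟨ interchange (r A ∩A) _ c k ⟩
    (r A ∩A + c) + (sumConsec A (f a) (map f as) + k) ≤⟨ +-mono-≤ r∩≤ (≤-reflexive (sumConsec-shift pa pas)) ⟩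
    r B (foldr _∩_ a as) + sumConsec B a as           ≤⟨ cond2 ⟩
    sumRanks B (a ∷ as)                               ≡⟨ sumRanks-shift (pa ∷ pas) ⟨
    sumRanks A (map f (a ∷ as)) + (c + k)             ∎)
    where
    open ≤-Reasoning
    ∩A = foldr _∩_ (f a) (map f as)
    k = length as * c

goodListing-transfer : ∀ (M N : MatroidData n) (x : Fin n) (P : Subset n → Set) →
  (∀ {F} → IsCyclicFlat N F → IsCyclicFlat M (cl M F) × P (cl M F)) →
  (∀ {F} → IsCyclicFlat N F → cl M F - x ≡ F) →
  (∀ {L} → All P L → Cond1 M L → Cond1 N (map (_- x) L)) →
  (∀ {L} → All P L → Cond2 M L → Cond2 N (map (_- x) L)) →
  GoodListing M → GoodListing N
goodListing-transfer M N x P lift unlift cond1 cond2 good L (L≢[] , cyclicL , incomparableL)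
  with good (map (cl M) L) (map≢[] (cl M) L≢[] , All.map⁺ (All.map (proj₁ ∘ lift) cyclicL) ,
         incomparable-map (cl M) (_- x) (─-mono-⊆ _) (All.map unlift cyclicL) incomparableL)
... | L′ , L′↭ , cond1L′ , cond2L′ = map (_- x) L′ , listing↭L , cond1 pL′ cond1L′ , cond2 pL′ cond2L′
  where
  pL′ : All P L′
  pL′ = All-resp-↭ (↭-sym L′↭) (All.map⁺ (All.map (proj₂ ∘ lift) cyclicL))
  listing↭L : map (_- x) L′ ↭ L
  listing↭L = ↭-trans (↭.map⁺ (_- x) L′↭)
    (↭-reflexive (trans (sym (map-∘ L)) (map-id-local (All.map unlift cyclicL))))

module Deletion {M : MatroidData n} (isM : IsMatroid M) (x : Fin n) where
  open Closure isM

  cl-delete : ∀ Y → cl (delete M x) Y ≡ cl M Y - x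
  cl-delete Y = ⊆-antisym
    (λ e∈clN → let e∈E-x , r≡ = ∈-cl⁻ (delete M x) e∈clN in
      x∈p∧x≢y⇒x∈p-y (∈-cl⁺ M (p-x⊆p (E M) e∈E-x) r≡) (x∈p-y⇒x≢y (E M) e∈E-x))
    (λ e∈clM-x → let e∈clM = p-x⊆p _ e∈clM-x in
      ∈-cl⁺ (delete M x) (x∈p∧x≢y⇒x∈p-y (cl⊆E M e∈clM) (x∈p-y⇒x≢y _ e∈clM-x)) (proj₂ (∈-cl⁻ M e∈clM)))

  Spanned : Subset n → Set
  Spanned Z = Z ⊆ E M × Z ⊆ cl M (Z - x)

  spanned-r-─x : ∀ {Z} → Spanned Z → r M (Z - x) ≡ r M Z
  spanned-r-─x {Z} (Z⊆E , Z⊆cl) = sym (r-between (λ z → Z⊆E (p-x⊆p Z z)) (p-x⊆p Z) Z⊆cl)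

  spanned-cl-─x : ∀ {Z} → Spanned Z → cl M (Z - x) ≡ cl M Z
  spanned-cl-─x {Z} (Z⊆E , Z⊆cl) = sym (cl-between (λ z → Z⊆E (p-x⊆p Z z)) (p-x⊆p Z) Z⊆cl)

  spanned-∪ : ∀ {Z W} → Spanned Z → Spanned W → Spanned (Z ∪ W)
  spanned-∪ {Z} {W} (Z⊆E , Z⊆cl) (W⊆E , W⊆cl) = Z∪W⊆E ,
    ∪-lub (λ z → cl-mono (─-mono-⊆ ⁅ x ⁆ (p⊆p∪q W)) Z∪W-x⊆E (Z⊆cl z))
          (λ z → cl-mono (─-mono-⊆ ⁅ x ⁆ (q⊆p∪q Z W)) Z∪W-x⊆E (W⊆cl z))
    where
    Z∪W⊆E : Z ∪ W ⊆ E M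
    Z∪W⊆E = ∪-lub Z⊆E W⊆E
    Z∪W-x⊆E : (Z ∪ W) - x ⊆ E M
    Z∪W-x⊆E z = Z∪W⊆E (p-x⊆p _ z)

  cl-spanned : ∀ {Z} → Spanned Z → Spanned (cl M Z)
  cl-spanned {Z} spZ@(Z⊆E , _) = cl⊆E M , λ e∈clZ →
    cl-mono (─-mono-⊆ ⁅ x ⁆ (⊆cl Z⊆E)) (λ z → cl⊆E M (p-x⊆p _ z))
      (subst (_ ∈_) (sym (spanned-cl-─x spZ)) e∈clZ)

  spanned-bigJoin : ∀ {a bs} → Spanned a → All Spanned bs → Spanned (bigJoin M a bs)
  spanned-bigJoin spa []           = spa
  spanned-bigJoin spa (spb ∷ spbs) = cl-spanned (spanned-∪ spa (spanned-bigJoin spb spbs))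

  bigJoin-delete : ∀ {a bs} → Spanned a → All Spanned bs →
    bigJoin (delete M x) (a - x) (map (_- x) bs) ≡ bigJoin M a bs - x
  bigJoin-delete             spa []           = refl
  bigJoin-delete {a} {b ∷ bs} spa (spb ∷ spbs) = begin
    cl (delete M x) ((a - x) ∪ bigJoin (delete M x) (b - x) (map (_- x) bs))
      ≡⟨ cong (λ S → cl (delete M x) ((a - x) ∪ S)) (bigJoin-delete spb spbs) ⟩
    cl (delete M x) ((a - x) ∪ (B - x))   ≡⟨ cong (cl (delete M x)) (─-distribʳ-∪ a B ⁅ x ⁆) ⟨
    cl (delete M x) ((a ∪ B) - x)         ≡⟨ cl-delete ((a ∪ B) - x) ⟩
    cl M ((a ∪ B) - x) - x                ≡⟨ cong (_- x) (spanned-cl-─x (spanned-∪ spa (spanned-bigJoin spb spbs))) ⟩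
    cl M (a ∪ B) - x                      ∎
    where
    open ≡-Reasoning
    B = bigJoin M b bs

  module _ {F} (cyclicF : IsCyclicFlat (delete M x) F) where

    F⊆E : F ⊆ E M
    F⊆E z = p-x⊆p (E M) (proj₁ (proj₁ cyclicF) z)

    cl-─x : cl M F - x ≡ F
    cl-─x = trans (sym (cl-delete F)) (proj₂ (proj₁ cyclicF))

    cl-lift : IsCyclicFlat M (cl M F) × Spanned (cl M F)
    cl-lift = noIsthmus⇒cl-cyclicFlat F⊆E (proj₂ cyclicF) ,
      cl⊆E M , subst (λ S → cl M F ⊆ cl M S) (sym cl-─x) (λ z → z)

  Cond2-delete : ∀ {L} → All Spanned L → Cond2 M L → Cond2 (delete M x) (map (_- x) L)
  Cond2-delete []    _ = _
  Cond2-delete {a ∷ as} spL@(spa ∷ _) cond2M = Cond2-shift spL r∩≤ cond2M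
    where
    open RankShift (delete M x) M (_- x) 0
      (λ spZ → trans (+-identityʳ _) (spanned-r-─x spZ))
      (λ {Z} {W} spZ spW → trans (+-identityʳ _)
        (trans (cong (r M) (sym (─-distribʳ-∪ Z W ⁅ x ⁆))) (spanned-r-─x (spanned-∪ spZ spW))))
    r∩≤ : r M (foldr _∩_ (a - x) (map (_- x) as)) + 0 ≤ r M (foldr _∩_ a as)
    r∩≤ = subst (_≤ r M (foldr _∩_ a as)) (sym (trans (+-identityʳ _) (cong (r M) (foldr-∩-─ ⁅ x ⁆ a as))))
      (r-monotone (p-x⊆p _) (λ z → proj₁ spa (foldr-∩⊆ a as z)))

  goodListing-delete : GoodListing M → GoodListing (delete M x)
  goodListing-delete = goodListing-transfer M (delete M x) x Spanned cl-lift cl-─x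
    (Cond1-map (delete M x) M (_- x) (_- x) (λ spa spbs _ → bigJoin-delete spa spbs))
    Cond2-delete

module Contraction {M : MatroidData n} (isM : IsMatroid M) (x : Fin n) (x∈E : x ∈ E M) where
  open Closure isM

  ⁅x⁆⊆E : ⁅ x ⁆ ⊆ E M
  ⁅x⁆⊆E = x∈p⇒⁅x⁆⊆p x∈E

  ∪⁅x⁆⊆E : ∀ {Y} → Y ⊆ E M → Y ∪ ⁅ x ⁆ ⊆ E M
  ∪⁅x⁆⊆E Y⊆E = ∪-lub Y⊆E ⁅x⁆⊆E

  r⁅x⁆≤r-∪⁅x⁆ : ∀ {Y} → Y ⊆ E M → r M ⁅ x ⁆ ≤ r M (Y ∪ ⁅ x ⁆)
  r⁅x⁆≤r-∪⁅x⁆ {Y} Y⊆E = r-monotone (q⊆p∪q Y ⁅ x ⁆) (∪⁅x⁆⊆E Y⊆E)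

  r-contract : ∀ {Y} → Y ⊆ E M → r (contract M x) Y + r M ⁅ x ⁆ ≡ r M (Y ∪ ⁅ x ⁆)
  r-contract Y⊆E = m∸n+n≡m (r⁅x⁆≤r-∪⁅x⁆ Y⊆E)

  r-contract-─x : ∀ {Z} → Z ⊆ E M → r (contract M x) (Z - x) + r M ⁅ x ⁆ ≡ r M (Z ∪ ⁅ x ⁆)
  r-contract-─x {Z} Z⊆E = trans (r-contract (λ z → Z⊆E (p-x⊆p Z z))) (cong (r M) (p─q∪q≡p∪q Z ⁅ x ⁆))

  cl-contract : ∀ {Y} → Y ⊆ E M → cl (contract M x) Y ≡ cl M (Y ∪ ⁅ x ⁆) - x
  cl-contract {Y} Y⊆E = ⊆-antisym clN⊆ ⊆clN
    where
    swap : ∀ e → (Y ∪ ⁅ e ⁆) ∪ ⁅ x ⁆ ≡ (Y ∪ ⁅ x ⁆) ∪ ⁅ e ⁆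
    swap e = p∪q∪s≡p∪s∪q Y ⁅ e ⁆ ⁅ x ⁆
    clN⊆ : cl (contract M x) Y ⊆ cl M (Y ∪ ⁅ x ⁆) - x
    clN⊆ {e} e∈clN =
      let e∈E-x , r≡ = ∈-cl⁻ (contract M x) e∈clN
          e∈E = p-x⊆p (E M) e∈E-x
      in x∈p∧x≢y⇒x∈p-y
           (∈-cl⁺ M e∈E (trans (cong (r M) (sym (swap e)))
             (∸-cancelʳ-≡ (r⁅x⁆≤r-∪⁅x⁆ (∪-lub Y⊆E (x∈p⇒⁅x⁆⊆p e∈E))) (r⁅x⁆≤r-∪⁅x⁆ Y⊆E) r≡)))
           (x∈p-y⇒x≢y (E M) e∈E-x)
    ⊆clN : cl M (Y ∪ ⁅ x ⁆) - x ⊆ cl (contract M x) Y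
    ⊆clN {e} e∈K-x =
      let e∈K = p-x⊆p _ e∈K-x
      in ∈-cl⁺ (contract M x) (x∈p∧x≢y⇒x∈p-y (cl⊆E M e∈K) (x∈p-y⇒x≢y _ e∈K-x))
           (cong (_∸ r M ⁅ x ⁆) (trans (cong (r M) (swap e)) (proj₂ (∈-cl⁻ M e∈K))))

  cl∪x : Subset n → Subset n
  cl∪x Y = cl M (Y ∪ ⁅ x ⁆)

  cl∪x-─x : ∀ Y → cl∪x (Y - x) ≡ cl∪x Y
  cl∪x-─x Y = cong (cl M) (p─q∪q≡p∪q Y ⁅ x ⁆)

  cl∪x-cl : ∀ {Y} → Y ⊆ E M → cl∪x (cl M Y) ≡ cl∪x Y
  cl∪x-cl {Y} Y⊆E = begin
    cl M (cl M Y ∪ ⁅ x ⁆) ≡⟨ cong (cl M) (∪-comm (cl M Y) ⁅ x ⁆) ⟩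
    cl M (⁅ x ⁆ ∪ cl M Y) ≡⟨ cl-∪-cl ⁅x⁆⊆E Y⊆E ⟩
    cl M (⁅ x ⁆ ∪ Y)      ≡⟨ cong (cl M) (∪-comm ⁅ x ⁆ Y) ⟩
    cl M (Y ∪ ⁅ x ⁆)      ∎
    where open ≡-Reasoning

  cl∪x-contract : ∀ {Y} → Y ⊆ E M → cl∪x (cl (contract M x) Y) ≡ cl∪x Y
  cl∪x-contract {Y} Y⊆E = begin
    cl∪x (cl (contract M x) Y)  ≡⟨ cong cl∪x (cl-contract Y⊆E) ⟩
    cl∪x (cl∪x Y - x)           ≡⟨ cl∪x-─x (cl∪x Y) ⟩
    cl∪x (cl∪x Y)               ≡⟨ cl∪x-cl (∪⁅x⁆⊆E Y⊆E) ⟩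
    cl M ((Y ∪ ⁅ x ⁆) ∪ ⁅ x ⁆)  ≡⟨ cong (cl M) (trans (∪-assoc Y ⁅ x ⁆ ⁅ x ⁆) (cong (Y ∪_) (∪-idem ⁅ x ⁆))) ⟩
    cl∪x Y                      ∎
    where open ≡-Reasoning

  cl∪x-∪ : ∀ {A B} → A ⊆ E M → B ⊆ E M → cl∪x (A ∪ B) ≡ cl M (cl∪x A ∪ cl∪x B)
  cl∪x-∪ {A} {B} A⊆E B⊆E = sym (begin
    cl M (cl∪x A ∪ cl∪x B)             ≡⟨ cl-∪-cl (cl⊆E M) (∪⁅x⁆⊆E B⊆E) ⟩
    cl M (cl∪x A ∪ (B ∪ ⁅ x ⁆))        ≡⟨ cong (cl M) (∪-comm (cl∪x A) (B ∪ ⁅ x ⁆)) ⟩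
    cl M ((B ∪ ⁅ x ⁆) ∪ cl∪x A)        ≡⟨ cl-∪-cl (∪⁅x⁆⊆E B⊆E) (∪⁅x⁆⊆E A⊆E) ⟩
    cl M ((B ∪ ⁅ x ⁆) ∪ (A ∪ ⁅ x ⁆))   ≡⟨ cong (cl M) (prove 3 ((b ⊕ x̂) ⊕ (a ⊕ x̂)) ((a ⊕ b) ⊕ x̂) (A ∷ B ∷ ⁅ x ⁆ ∷ [])) ⟩
    cl∪x (A ∪ B)                       ∎)
    where
    open ≡-Reasoning
    open ∪-Solver (∪-idempotentCommutativeMonoid n)
    a = var zero
    b = var (suc zero)
    x̂ = var (suc (suc zero))

  bigJoin-contract⊆E : ∀ {a} bs → a ⊆ E M → bigJoin (contract M x) (a - x) (map (_- x) bs) ⊆ E M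
  bigJoin-contract⊆E bs a⊆E z = p-x⊆p (E M) (bigJoin⊆E (contract M x) (map (_- x) bs) (─-mono-⊆ ⁅ x ⁆ a⊆E) z)

  cl∪x-bigJoin : ∀ {a} bs → a ⊆ E M → All (_⊆ E M) bs →
    cl∪x (bigJoin (contract M x) (a - x) (map (_- x) bs)) ≡ cl∪x (bigJoin M a bs)
  cl∪x-bigJoin {a} []       a⊆E []            = cl∪x-─x a
  cl∪x-bigJoin {a} (b ∷ bs) a⊆E (b⊆E ∷ bs⊆E) = begin
    cl∪x (cl (contract M x) ((a - x) ∪ B′)) ≡⟨ cl∪x-contract (∪-lub a-x⊆E B′⊆E) ⟩
    cl∪x ((a - x) ∪ B′)                     ≡⟨ cl∪x-∪ a-x⊆E B′⊆E ⟩
    cl M (cl∪x (a - x) ∪ cl∪x B′)           ≡⟨ cong₂ (λ S T → cl M (S ∪ T)) (cl∪x-─x a) (cl∪x-bigJoin bs b⊆E bs⊆E) ⟩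
    cl M (cl∪x a ∪ cl∪x B)                  ≡⟨ cl∪x-∪ a⊆E B⊆E ⟨
    cl∪x (a ∪ B)                            ≡⟨ cl∪x-cl (∪-lub a⊆E B⊆E) ⟨
    cl∪x (cl M (a ∪ B))                     ∎
    where
    open ≡-Reasoning
    B′ = bigJoin (contract M x) (b - x) (map (_- x) bs)
    B = bigJoin M b bs
    a-x⊆E : a - x ⊆ E M
    a-x⊆E z = a⊆E (p-x⊆p a z)
    B′⊆E : B′ ⊆ E M
    B′⊆E = bigJoin-contract⊆E bs b⊆E
    B⊆E : B ⊆ E M
    B⊆E = bigJoin⊆E M bs b⊆E

  bigJoin-contract : ∀ {a bs} → a ⊆ E M → All (_⊆ E M) bs → bs ≢ [] →
    bigJoin (contract M x) (a - x) (map (_- x) bs) ≡ cl∪x (bigJoin M a bs) - x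
  bigJoin-contract {bs = []}     _   _     []≢[] with () ← []≢[] refl
  bigJoin-contract {a} {b ∷ bs} a⊆E bs⊆E _ = begin
    cl (contract M x) T             ≡⟨ cl-contract T⊆E ⟩
    cl∪x T - x                      ≡⟨ cong (_- x) (cl∪x-contract T⊆E) ⟨
    cl∪x (cl (contract M x) T) - x  ≡⟨ cong (_- x) (cl∪x-bigJoin (b ∷ bs) a⊆E bs⊆E) ⟩
    cl∪x (bigJoin M a (b ∷ bs)) - x ∎
    where
    open ≡-Reasoning
    T = (a - x) ∪ bigJoin (contract M x) (b - x) (map (_- x) bs)
    T⊆E : T ⊆ E M
    T⊆E = ∪-lub (λ z → a⊆E (p-x⊆p a z)) (bigJoin-contract⊆E bs (All.head bs⊆E))

  module _ {F} (cyclicF : IsCyclicFlat (contract M x) F) where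

    F⊆E : F ⊆ E M
    F⊆E z = p-x⊆p (E M) (proj₁ (proj₁ cyclicF) z)

    x∉F : x ∉ F
    x∉F x∈F = x∈p-y⇒x≢y (E M) (proj₁ (proj₁ cyclicF) x∈F) refl

    cl-─⊆E : ∀ e → cl M F - e ⊆ E M
    cl-─⊆E e z = cl⊆E M (p-x⊆p _ z)

    F⊆cl-─x : F ⊆ cl M F - x
    F⊆cl-─x z∈F = x∈p∧x≢y⇒x∈p-y (⊆cl F⊆E z∈F) (λ { refl → x∉F z∈F })

    cl-─x : cl M F - x ≡ F
    cl-─x = ⊆-antisym
      (λ e∈ → subst (_ ∈_) (trans (sym (cl-contract F⊆E)) (proj₂ (proj₁ cyclicF)))
        (─-mono-⊆ ⁅ x ⁆ (cl-mono (p⊆p∪q _) (∪⁅x⁆⊆E F⊆E)) e∈))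
      F⊆cl-─x

    ∈cl∧≢x⇒∈ : ∀ {e} → e ∈ cl M F → e ≢ x → e ∈ F
    ∈cl∧≢x⇒∈ e∈clF e≢x = subst (_ ∈_) cl-─x (x∈p∧x≢y⇒x∈p-y e∈clF e≢x)

    r-─-∪⁅x⁆ : ∀ {e} → e ∈ F → r M ((F - e) ∪ ⁅ x ⁆) ≡ r M (F ∪ ⁅ x ⁆)
    r-─-∪⁅x⁆ {e} e∈F =
      ∸-cancelʳ-≡ (r⁅x⁆≤r-∪⁅x⁆ (λ z → F⊆E (p-x⊆p F z))) (r⁅x⁆≤r-∪⁅x⁆ F⊆E) (proj₂ cyclicF e e∈F)

    -- Since F has no isthmus in M / x, r ((F - e) ∪ x) = r (F ∪ x). If x ∈ cl F, then
    -- (F - e) ∪ x ⊆ cl F - e; otherwise x raises the rank of F, hence also that of F - e.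
    r≤r-cl- : ∀ {e} → e ∈ cl M F → r M F ≤ r M (cl M F - e)
    r≤r-cl- {e} e∈clF with e ≟ᶠ x
    ... | yes refl = r-monotone F⊆cl-─x (cl-─⊆E x)
    ... | no e≢x with x ∈? cl M F
    ...   | yes x∈clF = begin
      r M F                  ≤⟨ r-monotone (p⊆p∪q _) (∪⁅x⁆⊆E F⊆E) ⟩
      r M (F ∪ ⁅ x ⁆)        ≡⟨ r-─-∪⁅x⁆ (∈cl∧≢x⇒∈ e∈clF e≢x) ⟨
      r M ((F - e) ∪ ⁅ x ⁆)  ≤⟨ r-monotone (∪-lub (─-mono-⊆ ⁅ e ⁆ (⊆cl F⊆E))
                                  (x∈p⇒⁅x⁆⊆p (x∈p∧x≢y⇒x∈p-y x∈clF (e≢x ∘ sym)))) (cl-─⊆E e) ⟩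
      r M (cl M F - e)       ∎
      where open ≤-Reasoning
    ...   | no x∉clF = ≤-trans (+-cancelʳ-≤ 1 (r M F) (r M (F - e)) (begin
      r M F + 1              ≡⟨ +-comm (r M F) 1 ⟩
      suc (r M F)            ≤⟨ ∉cl⇒r<r-∪⁅⁆ F⊆E x∈E x∉clF ⟩
      r M (F ∪ ⁅ x ⁆)        ≡⟨ r-─-∪⁅x⁆ (∈cl∧≢x⇒∈ e∈clF e≢x) ⟨
      r M ((F - e) ∪ ⁅ x ⁆)  ≤⟨ r-∪⁅⁆≤r+1 (λ z → F⊆E (p-x⊆p F z)) x∈E ⟩
      r M (F - e) + 1        ∎))
      (r-monotone (─-mono-⊆ ⁅ e ⁆ (⊆cl F⊆E)) (cl-─⊆E e))
      where open ≤-Reasoning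

    cl-lift : IsCyclicFlat M (cl M F) × IsFlat M (cl M F)
    cl-lift = let cyclic = cl-cyclicFlat F⊆E r≤r-cl- in cyclic , proj₁ cyclic

  -- Y ↦ r (Y ∪ x) is the rank of M / x shifted by r {x}, so (ii) for it gives (ii) for M / x.
  M⁺ : MatroidData n
  M⁺ = mkMatroidData (E M) (λ Y → r M (Y ∪ ⁅ x ⁆))

  misses : List (Subset n) → ℕ
  misses []       = 0
  misses (Z ∷ Zs) with x ∈? Z
  ... | yes _ = misses Zs
  ... | no  _ = 1

  r-∪⁅x⁆≤r+misses : ∀ {Z} L → Z ⊆ E M → (All (x ∈_) L → x ∈ Z) → r M (Z ∪ ⁅ x ⁆) ≤ r M Z + misses L
  r-∪⁅x⁆≤r+misses []      Z⊆E x∈Z = ≤-reflexive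
    (trans (cong (r M) (q⊆p⇒p∪q≡p (x∈p⇒⁅x⁆⊆p (x∈Z [])))) (sym (+-identityʳ _)))
  r-∪⁅x⁆≤r+misses (Y ∷ L) Z⊆E x∈Z with x ∈? Y
  ... | yes x∈Y = r-∪⁅x⁆≤r+misses L Z⊆E (x∈Z ∘ (x∈Y ∷_))
  ... | no  _   = r-∪⁅⁆≤r+1 Z⊆E x∈E

  ∉flat⇒r-∪⁅x⁆≡1+r : ∀ {Z} → IsFlat M Z → x ∉ Z → r M (Z ∪ ⁅ x ⁆) ≡ suc (r M Z)
  ∉flat⇒r-∪⁅x⁆≡1+r {Z} (Z⊆E , clZ≡Z) x∉Z = ≤-antisym
    (subst (r M (Z ∪ ⁅ x ⁆) ≤_) (+-comm (r M Z) 1) (r-∪⁅⁆≤r+1 Z⊆E x∈E))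
    (∉cl⇒r<r-∪⁅⁆ Z⊆E x∈E (subst (x ∉_) (sym clZ≡Z) x∉Z))

  misses-head : ∀ {a b} rest → IsFlat M a → b ⊆ E M →
    r M ((a ∪ b) ∪ ⁅ x ⁆) + misses (a ∷ b ∷ rest) + r M a ≤
    r M (a ∪ b) + misses (b ∷ rest) + r M (a ∪ ⁅ x ⁆)
  misses-head {a} {b} rest flat-a@(a⊆E , _) b⊆E with x ∈? a
  ... | yes x∈a = +-mono-≤
    (≤-reflexive (cong (λ S → r M S + misses (b ∷ rest)) (q⊆p⇒p∪q≡p (x∈p⇒⁅x⁆⊆p (p⊆p∪q b x∈a)))))
    (r-monotone (p⊆p∪q _) (∪⁅x⁆⊆E a⊆E))
  ... | no x∉a = begin
    r M ((a ∪ b) ∪ ⁅ x ⁆) + 1 + r M a   ≡⟨ +-assoc (r M ((a ∪ b) ∪ ⁅ x ⁆)) 1 (r M a) ⟩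
    r M ((a ∪ b) ∪ ⁅ x ⁆) + suc (r M a) ≤⟨ +-mono-≤
      (r-∪⁅x⁆≤r+misses (b ∷ rest) (∪-lub a⊆E b⊆E) (λ { (x∈b ∷ _) → q⊆p∪q a b x∈b }))
      (≤-reflexive (sym (∉flat⇒r-∪⁅x⁆≡1+r flat-a x∉a))) ⟩
    r M (a ∪ b) + misses (b ∷ rest) + r M (a ∪ ⁅ x ⁆) ∎
    where open ≤-Reasoning

  sumConsec⁺-bound : ∀ {a as} → All (IsFlat M) (a ∷ as) →
    sumConsec M⁺ a as + misses (a ∷ as) + sumRanks M (a ∷ as) ≤ sumConsec M a as + sumRanks M⁺ (a ∷ as)
  sumConsec⁺-bound {a} {[]} (flat-a ∷ []) with x ∈? a
  ... | yes _   = +-monoˡ-≤ 0 (r-monotone (p⊆p∪q _) (∪⁅x⁆⊆E (proj₁ flat-a)))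
  ... | no x∉a  = ≤-reflexive (cong (_+ 0) (sym (∉flat⇒r-∪⁅x⁆≡1+r flat-a x∉a)))
  sumConsec⁺-bound {a} {b ∷ rest} (flat-a ∷ flats) = +-cancelʳ-≤ m _ _ (begin
    (P⁺ + C⁺) + m′ + (ra + S) + m  ≡⟨ regroupˡ P⁺ C⁺ m′ ra S m ⟩
    (P⁺ + m′ + ra) + (C⁺ + m + S)  ≤⟨ +-mono-≤ (misses-head rest flat-a (proj₁ (All.head flats)))
                                                (sumConsec⁺-bound flats) ⟩
    (P + m + ra⁺) + (C + S⁺)       ≡⟨ regroupʳ P m ra⁺ C S⁺ ⟩
    (P + C) + (ra⁺ + S⁺) + m       ∎)
    where
    open ≤-Reasoning
    P⁺ = r M ((a ∪ b) ∪ ⁅ x ⁆)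
    P = r M (a ∪ b)
    m′ = misses (a ∷ b ∷ rest)
    m = misses (b ∷ rest)
    ra = r M a
    ra⁺ = r M (a ∪ ⁅ x ⁆)
    C⁺ = sumConsec M⁺ b rest
    C = sumConsec M b rest
    S = sumRanks M (b ∷ rest)
    S⁺ = sumRanks M⁺ (b ∷ rest)
    regroupˡ : ∀ a b c d e f → (a + b) + c + (d + e) + f ≡ (a + c + d) + (b + f + e)
    regroupˡ = solve-∀
    regroupʳ : ∀ a b c d e → (a + b + c) + (d + e) ≡ (a + d) + (c + e) + b
    regroupʳ = solve-∀

  Cond2⁺ : ∀ {a as} → All (IsFlat M) (a ∷ as) → Cond2 M (a ∷ as) → Cond2 M⁺ (a ∷ as)
  Cond2⁺ {a} {as} flats@((a⊆E , _) ∷ _) cond2M = +-cancelʳ-≤ SR _ _ (begin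
    r M (F ∪ ⁅ x ⁆) + SC⁺ + SR              ≤⟨ +-monoˡ-≤ SR (+-monoˡ-≤ SC⁺
                                                 (r-∪⁅x⁆≤r+misses (a ∷ as) ∩⊆E (λ { (x∈a ∷ x∈as) → ∈-foldr-∩ x∈a x∈as }))) ⟩
    r M F + misses (a ∷ as) + SC⁺ + SR      ≡⟨ regroup (r M F) (misses (a ∷ as)) SC⁺ SR ⟩
    r M F + (SC⁺ + misses (a ∷ as) + SR)    ≤⟨ +-monoʳ-≤ (r M F) (sumConsec⁺-bound flats) ⟩
    r M F + (SC + SR⁺)                      ≡⟨ +-assoc (r M F) SC SR⁺ ⟨
    r M F + SC + SR⁺                        ≤⟨ +-monoˡ-≤ SR⁺ cond2M ⟩
    SR + SR⁺                                ≡⟨ +-comm SR SR⁺ ⟩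
    SR⁺ + SR                                ∎)
    where
    open ≤-Reasoning
    F = foldr _∩_ a as
    ∩⊆E : F ⊆ E M
    ∩⊆E z = a⊆E (foldr-∩⊆ a as z)
    SC = sumConsec M a as
    SC⁺ = sumConsec M⁺ a as
    SR = sumRanks M (a ∷ as)
    SR⁺ = sumRanks M⁺ (a ∷ as)
    regroup : ∀ a b c d → a + b + c + d ≡ a + (c + b + d)
    regroup = solve-∀

  Cond2-contract : ∀ {L} → All (IsFlat M) L → Cond2 M L → Cond2 (contract M x) (map (_- x) L)
  Cond2-contract []    _ = _
  Cond2-contract {a ∷ as} flats@((a⊆E , _) ∷ _) cond2M =
    Cond2-shift (All.map proj₁ flats) (≤-reflexive r∩-shift) (Cond2⁺ flats cond2M)
    where
    open RankShift (contract M x) M⁺ (_- x) (r M ⁅ x ⁆) r-contract-─x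
      (λ {Z} {W} Z⊆E W⊆E → trans
        (cong (λ S → r (contract M x) S + r M ⁅ x ⁆) (sym (─-distribʳ-∪ Z W ⁅ x ⁆)))
        (r-contract-─x (∪-lub Z⊆E W⊆E)))
    r∩-shift : r (contract M x) (foldr _∩_ (a - x) (map (_- x) as)) + r M ⁅ x ⁆ ≡ r M⁺ (foldr _∩_ a as)
    r∩-shift = trans (cong (λ S → r (contract M x) S + r M ⁅ x ⁆) (foldr-∩-─ ⁅ x ⁆ a as))
      (r-contract-─x (λ z → a⊆E (foldr-∩⊆ a as z)))

  goodListing-contract : GoodListing M → GoodListing (contract M x)
  goodListing-contract = goodListing-transfer M (contract M x) x (IsFlat M) cl-lift cl-─x
    (Cond1-map (contract M x) M (_- x) (λ Z → cl∪x Z - x)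
      (λ (a⊆E , _) flat-bs → bigJoin-contract a⊆E (All.map proj₁ flat-bs)))
    Cond2-contract

lemma3p9 : ∀ {n : ℕ} (M : MatroidData n) → IsMatroid M → (x : Fin n) → x ∈ E M →
    GoodListing M → GoodListing (delete M x) × GoodListing (contract M x)
lemma3p9 M isM x x∈E good =
  Deletion.goodListing-delete isM x good , Contraction.goodListing-contract isM x x∈E good
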